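{- Let $A$ and $B$ be $n\times n$ type-II matrices and let $R,S$ be $n\times n$ complex matrices. The following are equivalent: (a) $R\in\mathcal N_{A,B}$ and $S=\Theta_{A,B}(R)$; (b) $X_R\Delta_BX_A=\Delta_BX_A\Delta_S$; (c) $X_R\Delta_AX_B=\Delta_AX_B\Delta_{S^T}$; (d) $\Delta_{B^T}X_{(B^{(-)})^T}\Delta_{nR}=X_{S^T}\Delta_{(A^{(-)})^T}X_{A^T}$; (e) $\Delta_{(A^{(-)})^T}X_{A^T}\Delta_{nR^T}=X_S\Delta_{B^T}X_{(B^{(-)})^T}$.
   Context: All matrices are complex; compositions of operators are read right to left. For $n\times n$ matrices $X,Y$, $X\circ Y$ is the Schur (entrywise) product; if $X$ has no zero entry, $X^{(-)}$ is its Schur inverse, $(X^{(-)})_{ij}=1/X_{ij}$. An $n\times n$ matrix $W$ is type-II if $W(W^{(-)})^T=nI$. For an $n\times n$ matrix $C$, $X_C$ and $\Delta_C$ are the linear operators on $M_n(\mathbb C)$ given by $X_C(M)=CM$ and $\Delta_C(M)=C\circ M$. With $e_1,\dots,e_n$ the standard basis of $\mathbb C^n$, $\mathcal N_{A,B}$ is the set of $n\times n$ matrices $M$ such that every vector $Ae_i\circ Be_j$ ($1\le i,j\le n$) is an eigenvector of $M$, and for $M\in\mathcal N_{A,B}$, $\Theta_{A,B}(M)$ is the $n\times n$ matrix with $M(Ae_i\circ Be_j)=\Theta_{A,B}(M)_{ij}(Ae_i\circ Be_j)$. -}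

module Defs where

open import Level using (_⊔_)
open import Data.Nat using (ℕ; zero; suc)
open import Data.Fin using (Fin; _≟_)

open import Data.Product using (Σ; ∃; _,_; proj₁)
open import Relation.Nullary using (¬_; yes; no)
open import Algebra.Bundles using (CommutativeRing)

ιᴿ : ∀ {c ℓ} (R : CommutativeRing c ℓ) → ℕ → CommutativeRing.Carrier R
ιᴿ R zero    = CommutativeRing.0# R
ιᴿ R (suc k) = CommutativeRing._+_ R (CommutativeRing.1# R) (ιᴿ R k)

-- A field of characteristic zero, standing in for ℂ.
record Field0 (c ℓ : Level.Level) : Set (Level.suc (c ⊔ ℓ)) where
  field
    commutativeRing : CommutativeRing c ℓ
  open CommutativeRing commutativeRing public
  ι : ℕ → Carrier
  ι = ιᴿ commutativeRing
  field
    inv        : (x : Carrier) → ¬ (x ≈ 0#) → Carrier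
    inverseʳ   : (x : Carrier) (p : ¬ (x ≈ 0#)) → x * inv x p ≈ 1#
    charZero   : (k : ℕ) → ¬ (ιᴿ commutativeRing (suc k) ≈ 0#)

module MatrixDefs {c ℓ} (F : Field0 c ℓ) where
  open Field0 F

  Vect : ℕ → Set c
  Vect n = Fin n → Carrier

  Mat : ℕ → Set c
  Mat n = Fin n → Fin n → Carrier

  Σᶠ : (n : ℕ) → (Fin n → Carrier) → Carrier
  Σᶠ zero    f = 0#
  Σᶠ (suc n) f = f Fin.zero + Σᶠ n (λ i → f (Fin.suc i))

  _≈ᵛ_ : {n : ℕ} → Vect n → Vect n → Set ℓ
  u ≈ᵛ v = ∀ k → u k ≈ v k

  _≈ᴹ_ : {n : ℕ} → Mat n → Mat n → Set ℓ
  X ≈ᴹ Y = ∀ i j → X i j ≈ Y i j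

  _·_ : {n : ℕ} → Mat n → Mat n → Mat n
  _·_ {n} X Y i j = Σᶠ n (λ k → X i k * Y k j)

  _ᵀ : {n : ℕ} → Mat n → Mat n
  (X ᵀ) i j = X j i

  _∘ˢ_ : {n : ℕ} → Mat n → Mat n → Mat n
  (X ∘ˢ Y) i j = X i j * Y i j

  _⊙_ : {n : ℕ} → Carrier → Mat n → Mat n
  (a ⊙ X) i j = a * X i j

  I : {n : ℕ} → Mat n
  I i j with i ≟ j
  ... | yes _ = 1#
  ... | no  _ = 0#

  _▹_ : {n : ℕ} → Mat n → Vect n → Vect n
  _▹_ {n} X v i = Σᶠ n (λ k → X i k * v k)

  NoZeroEntry : {n : ℕ} → Mat n → Set ℓ
  NoZeroEntry X = ∀ i j → ¬ (X i j ≈ 0#)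

  schurInv : {n : ℕ} (X : Mat n) → NoZeroEntry X → Mat n
  schurInv X h i j = inv (X i j) (h i j)

  record TypeII {n : ℕ} (W : Mat n) : Set (c ⊔ ℓ) where
    field
      noZero : NoZeroEntry W
      typeII : (W · (schurInv W noZero ᵀ)) ≈ᴹ (ι n ⊙ I)

  Op : ℕ → Set c
  Op n = Mat n → Mat n

  _⊚_ : {n : ℕ} → Op n → Op n → Op n
  (F₁ ⊚ F₂) M = F₁ (F₂ M)

  _≈ᴼ_ : {n : ℕ} → Op n → Op n → Set (c ⊔ ℓ)
  F₁ ≈ᴼ F₂ = ∀ M → F₁ M ≈ᴹ F₂ M

  Xₒ : {n : ℕ} → Mat n → Op n
  Xₒ C M = C · M

  Δₒ : {n : ℕ} → Mat n → Op n
  Δₒ C M = C ∘ˢ M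

  col∘ : {n : ℕ} → Mat n → Mat n → Fin n → Fin n → Vect n
  col∘ A B i j k = A k i * B k j

  IsEigenvector : {n : ℕ} → Mat n → Vect n → Set (c ⊔ ℓ)
  IsEigenvector {n} M v = (¬ (∀ k → v k ≈ 0#)) Data.Product.× (Σ Carrier λ λ' → (M ▹ v) ≈ᵛ (λ k → λ' * v k))

  InN : {n : ℕ} → Mat n → Mat n → Mat n → Set (c ⊔ ℓ)
  InN A B M = ∀ i j → IsEigenvector M (col∘ A B i j)

  Θ : {n : ℕ} (A B M : Mat n) → InN A B M → Mat n
  Θ A B M p i j = proj₁ (Data.Product.proj₂ (p i j))

{-# OPTIONS --safe #-}
module Submission where

-- The eigen-equations R (A e_i ∘ B e_j) = S_ij (A e_i ∘ B e_j) are the content of (a). Each operator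
-- identity in (b)-(e) acts column by column on its argument, so it holds iff the coefficient arrays
-- of its two sides agree; for (b) these are the eigen-equations themselves, and (c) is (b) with
-- A, B and S, Sᵀ exchanged. For (d) the coefficient identity is, column by column, the
-- eigen-equations multiplied on the right by A⁻ᵀ (and scaled by an entry of B), and (e) is (d) for
-- the exchanged data. The step (d) ⇒ (a) needs A⁻ᵀ to be invertible: the type-II condition only
-- says A A⁻ᵀ = n I, and A⁻ᵀ A = n I follows because a right inverse of a square matrix over a field
-- is a left inverse. That is shown with determinants (Laplace expansion along the first column):
-- adj(X) X = det X · I, and det X ≉ 0 whenever X has a right inverse, by induction on the size.

open import Defs
open import Algebra.Bundles using (CommutativeRing)
open import Data.Empty using (⊥-elim)
open import Data.Fin using (Fin; zero; suc; punchIn; lift; _≟_)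
open import Data.Fin.Permutation as Perm using (Permutation′; _⟨$⟩ʳ_)
open import Data.Fin.Properties using (punchInᵢ≢i; punchIn-injective; sequence)
open import Data.Nat using (ℕ; zero; suc)
open import Data.Product using (Σ; _×_; _,_; proj₂)
open import Effect.Monad using (RawMonad)
open import Function using (_∘_)
open import Function.Bundles using (_⇔_; mk⇔; Equivalence)
open import Function.Properties.Equivalence using () renaming (trans to ⇔-trans; sym to ⇔-sym)
open import Level using (_⊔_)
open import Relation.Binary.Core using (_Preserves_⟶_)
open import Relation.Binary.PropositionalEquality as ≡ using (_≡_; _≢_; _≗_)
open import Relation.Nullary using (¬_; Dec; yes; no)
open import Relation.Nullary.Negation using (¬¬-Monad)

module Matrices {c ℓ} (R : CommutativeRing c ℓ) where
  open CommutativeRing R hiding (zero)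
  open import Algebra.Properties.Ring ring
    using (-‿distribˡ-*; -‿distribʳ-*; -‿involutive; -0#≈0#; -‿+-comm; ⁻¹-anti-homo‿-)
  open import Algebra.Properties.CommutativeSemigroup *-commutativeSemigroup using (xy∙z≈xz∙y)
  open import Algebra.Solver.CommutativeMonoid *-commutativeMonoid using (solve; _⊕_; _⊜_; id)
  open import Relation.Binary.Reasoning.Setoid setoid

  -- Sums are opaque so that unification never unfolds the fold they are defined by.
  module _ where
    import Algebra.Properties.Semiring.Sum semiring as Sum

    opaque
      ∑ : ∀ n → (Fin n → Carrier) → Carrier
      ∑ n f = Sum.sum f

      ∑-empty : (f : Fin zero → Carrier) → ∑ zero f ≈ 0#
      ∑-empty f = refl

      ∑-suc : ∀ {n} (f : Fin (suc n) → Carrier) → ∑ (suc n) f ≈ f zero + ∑ n (f ∘ suc)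
      ∑-suc f = refl

      ∑-cong : ∀ {n} {f g : Fin n → Carrier} → (∀ i → f i ≈ g i) → ∑ n f ≈ ∑ n g
      ∑-cong = Sum.sum-cong-≋

      ∑-zero : ∀ {n} {f : Fin n → Carrier} → (∀ i → f i ≈ 0#) → ∑ n f ≈ 0#
      ∑-zero {n} f≈0 = trans (Sum.sum-cong-≋ f≈0) (Sum.sum-replicate-zero n)

      ∑-distrib-+ : ∀ {n} (f g : Fin n → Carrier) → ∑ n (λ i → f i + g i) ≈ ∑ n f + ∑ n g
      ∑-distrib-+ = Sum.∑-distrib-+

      *-distribˡ-∑ : ∀ {n} x (f : Fin n → Carrier) → x * ∑ n f ≈ ∑ n (λ i → x * f i)
      *-distribˡ-∑ = Sum.*-distribˡ-sum

      *-distribʳ-∑ : ∀ {n} x (f : Fin n → Carrier) → ∑ n f * x ≈ ∑ n (λ i → f i * x)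
      *-distribʳ-∑ = Sum.*-distribʳ-sum

      ∑-comm : ∀ {m n} (f : Fin m → Fin n → Carrier) →
               ∑ m (λ i → ∑ n (f i)) ≈ ∑ n (λ j → ∑ m (λ i → f i j))
      ∑-comm = Sum.∑-comm

      ∑-remove : ∀ {n} (i : Fin (suc n)) (f : Fin (suc n) → Carrier) →
                 ∑ (suc n) f ≈ f i + ∑ n (f ∘ punchIn i)
      ∑-remove i = Sum.sum-remove

      ∑-permute : ∀ {n} (f : Fin n → Carrier) (π : Permutation′ n) → ∑ n f ≈ ∑ n (f ∘ (π ⟨$⟩ʳ_))
      ∑-permute = Sum.∑-permute

  ∑-neg : ∀ {n} (f : Fin n → Carrier) → ∑ n (λ i → - f i) ≈ - ∑ n f
  ∑-neg {zero}  f = trans (∑-empty _) (sym (trans (-‿cong (∑-empty f)) -0#≈0#))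
  ∑-neg {suc n} f = begin
    ∑ (suc n) (λ i → - f i)             ≈⟨ ∑-suc _ ⟩
    - f zero + ∑ n (λ i → - f (suc i))  ≈⟨ +-congˡ (∑-neg (f ∘ suc)) ⟩
    - f zero + - ∑ n (f ∘ suc)          ≈⟨ -‿+-comm _ _ ⟩
    - (f zero + ∑ n (f ∘ suc))          ≈⟨ -‿cong (sym (∑-suc f)) ⟩
    - ∑ (suc n) f                       ∎

  -‿*-comm : ∀ x y → - x * y ≈ - (x * y)
  -‿*-comm x y = sym (-‿distribˡ-* x y)

  *-‿comm : ∀ x y → x * - y ≈ - (x * y)
  *-‿comm x y = sym (-‿distribʳ-* x y)

  ∑-*-sub : ∀ {n} (f g h : Fin n → Carrier) →
            ∑ n (λ j → f j * (g j + - h j)) ≈ ∑ n (λ j → f j * g j) + - ∑ n (λ j → f j * h j)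
  ∑-*-sub f g h = begin
    ∑ _ (λ j → f j * (g j + - h j))
      ≈⟨ ∑-cong (λ j → trans (distribˡ _ _ _) (+-congˡ (*-‿comm _ _))) ⟩
    ∑ _ (λ j → f j * g j + - (f j * h j))              ≈⟨ ∑-distrib-+ _ _ ⟩
    ∑ _ (λ j → f j * g j) + ∑ _ (λ j → - (f j * h j))  ≈⟨ +-congˡ (∑-neg _) ⟩
    ∑ _ (λ j → f j * g j) + - ∑ _ (λ j → f j * h j)    ∎

  ∑-single : ∀ {n} (i : Fin n) (f : Fin n → Carrier) → (∀ k → k ≢ i → f k ≈ 0#) → ∑ n f ≈ f i
  ∑-single {suc n} i f f≈0 = begin
    ∑ (suc n) f                ≈⟨ ∑-remove i f ⟩
    f i + ∑ n (f ∘ punchIn i)  ≈⟨ +-congˡ (∑-zero (λ k → f≈0 (punchIn i k) (punchInᵢ≢i i k))) ⟩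
    f i + 0#                   ≈⟨ +-identityʳ _ ⟩
    f i                        ∎

  Matrix : ℕ → ℕ → Set c
  Matrix m n = Fin m → Fin n → Carrier

  sign : ∀ {n} → Fin n → Carrier
  sign zero    = 1#
  sign (suc k) = - sign k

  minor : ∀ {n} → Fin (suc n) → Matrix (suc n) (suc n) → Matrix n n
  minor k M i j = M (punchIn k i) (suc j)

  det : ∀ n → Matrix n n → Carrier
  det zero    M = 1#
  det (suc n) M = ∑ (suc n) (λ k → sign k * M k zero * det n (minor k M))

  det-cong : ∀ n {M N : Matrix n n} → (∀ i j → M i j ≈ N i j) → det n M ≈ det n N
  det-cong zero    M≈N = refl
  det-cong (suc n) M≈N = ∑-cong λ k →
    *-cong (*-congˡ (M≈N k zero)) (det-cong n (λ i j → M≈N (punchIn k i) (suc j)))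

  -- In a matrix of size q + 2 with first two columns a and b, D ρ stands for the determinant of the
  -- remaining q columns restricted to the rows ρ; doubleExpansion is then its Laplace expansion
  -- along the first two columns.
  Minors : ℕ → Set c
  Minors q = (Fin q → Fin (suc (suc q))) → Carrier

  doubleExpansion : ∀ q (a b : Fin (suc (suc q)) → Carrier) → Minors q → Carrier
  doubleExpansion q a b D = ∑ (suc (suc q)) (λ k → sign k * a k *
    ∑ (suc q) (λ l → sign l * b (punchIn k l) * D (λ i → punchIn k (punchIn l i))))

  headExpansion : ∀ q (b : Fin (suc (suc q)) → Carrier) → Minors q → Carrier
  headExpansion q b D = ∑ (suc q) (λ l → sign l * b (suc l) * D (λ i → suc (punchIn l i)))

  tailExpansion : ∀ q (a b : Fin (suc (suc q)) → Carrier) → Minors q → Carrier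
  tailExpansion q a b D = ∑ (suc q) (λ k → sign k * a (suc k) *
    ∑ q (λ l → sign l * b (suc (punchIn k l)) * D (λ i → punchIn (suc k) (punchIn (suc l) i))))

  doubleExpansion-split : ∀ q a b D → doubleExpansion q a b D ≈
    (a zero * headExpansion q b D + - (b zero * headExpansion q a D)) + tailExpansion q a b D
  doubleExpansion-split q a b D = begin
    doubleExpansion q a b D
      ≈⟨ ∑-suc _ ⟩
    1# * a zero * hb + ∑ (suc q) (λ k → - sign k * a (suc k) * inner k)
      ≈⟨ +-cong (*-congʳ (*-identityˡ _)) (∑-cong split) ⟩
    a zero * hb + ∑ (suc q) (λ k → - (b zero * (sign k * a (suc k) * t k)) + sign k * a (suc k) * g k)
      ≈⟨ +-congˡ (∑-distrib-+ _ _) ⟩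
    a zero * hb + (∑ (suc q) (λ k → - (b zero * (sign k * a (suc k) * t k))) + tailExpansion q a b D)
      ≈⟨ +-congˡ (+-congʳ (trans (∑-neg _) (-‿cong (sym (*-distribˡ-∑ (b zero) _))))) ⟩
    a zero * hb + (- (b zero * headExpansion q a D) + tailExpansion q a b D)
      ≈⟨ sym (+-assoc _ _ _) ⟩
    (a zero * hb + - (b zero * headExpansion q a D)) + tailExpansion q a b D ∎
    where
    hb : Carrier
    hb = headExpansion q b D
    inner : Fin (suc q) → Carrier
    inner k = ∑ (suc q) (λ l → sign l * b (punchIn (suc k) l) * D (λ i → punchIn (suc k) (punchIn l i)))
    t : Fin (suc q) → Carrier
    t k = D (λ i → suc (punchIn k i))
    g : Fin (suc q) → Carrier
    g k = ∑ q (λ l → sign l * b (suc (punchIn k l)) * D (λ i → punchIn (suc k) (punchIn (suc l) i)))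
    split : ∀ k → - sign k * a (suc k) * inner k ≈ - (b zero * (sign k * a (suc k) * t k)) + sign k * a (suc k) * g k
    split k = begin
      - sign k * a (suc k) * inner k
        ≈⟨ *-cong (-‿*-comm _ _) (trans (∑-suc _) (+-congˡ (trans (∑-cong (λ l → -‿*-comm² _ _ _)) (∑-neg _)))) ⟩
      - (sign k * a (suc k)) * (1# * b zero * t k + - g k)
        ≈⟨ distribˡ _ _ _ ⟩
      - (sign k * a (suc k)) * (1# * b zero * t k) + - (sign k * a (suc k)) * - g k
        ≈⟨ +-cong (trans (-‿*-comm _ _) (-‿cong (reorder _ _ _ _)))
                  (trans (-‿*-comm _ _) (trans (-‿cong (*-‿comm _ _)) (-‿involutive _))) ⟩
      - (b zero * (sign k * a (suc k) * t k)) + sign k * a (suc k) * g k ∎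
      where
      -‿*-comm² : ∀ x y z → - x * y * z ≈ - (x * y * z)
      -‿*-comm² x y z = trans (*-congʳ (-‿*-comm x y)) (-‿*-comm _ _)
      reorder : ∀ s x y z → s * x * (1# * y * z) ≈ y * (s * x * z)
      reorder = solve 4 (λ s x y z → (s ⊕ x) ⊕ ((id ⊕ y) ⊕ z) ⊜ y ⊕ ((s ⊕ x) ⊕ z)) refl

  tailExpansion-zero : ∀ a b D → tailExpansion zero a b D ≈ 0#
  tailExpansion-zero a b D = ∑-zero (λ k → trans (*-congˡ (∑-empty _)) (zeroʳ _))

  tailExpansion-suc : ∀ q a b (D : Minors (suc q)) → D Preserves _≗_ ⟶ _≈_ →
                      tailExpansion (suc q) a b D ≈ doubleExpansion q (a ∘ suc) (b ∘ suc) (D ∘ lift 1)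
  tailExpansion-suc q a b D D-resp = ∑-cong λ k → *-congˡ (∑-cong λ l → *-congˡ (D-resp (punchIn-lift k l)))
    where
    punchIn-lift : ∀ k l → (λ i → punchIn (suc k) (punchIn (suc l) i)) ≗ lift 1 (λ i → punchIn k (punchIn l i))
    punchIn-lift k l zero    = ≡.refl
    punchIn-lift k l (suc i) = ≡.refl

  lift-resp : ∀ {q r} (D : (Fin (suc q) → Fin (suc r)) → Carrier) →
              D Preserves _≗_ ⟶ _≈_ → (D ∘ lift 1) Preserves _≗_ ⟶ _≈_
  lift-resp D D-resp ρ≗σ = D-resp λ { zero → ≡.refl ; (suc i) → ≡.cong suc (ρ≗σ i) }

  -- The terms of the split that involve a zero and b zero are antisymmetric (resp. cancel) by
  -- inspection, and the tail is a double expansion of size one less.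
  mutual
    doubleExpansion-antisym : ∀ q a b D → D Preserves _≗_ ⟶ _≈_ →
                              doubleExpansion q a b D ≈ - doubleExpansion q b a D
    doubleExpansion-antisym q a b D D-resp = begin
      doubleExpansion q a b D                                    ≈⟨ doubleExpansion-split q a b D ⟩
      (a zero * hb + - (b zero * ha)) + tailExpansion q a b D    ≈⟨ +-congˡ (tailExpansion-antisym q a b D D-resp) ⟩
      (a zero * hb + - (b zero * ha)) + - tailExpansion q b a D  ≈⟨ negate _ _ _ ⟩
      - ((b zero * ha + - (a zero * hb)) + tailExpansion q b a D) ≈⟨ -‿cong (sym (doubleExpansion-split q b a D)) ⟩
      - doubleExpansion q b a D                                  ∎
      where
      ha : Carrier
      ha = headExpansion q a D
      hb : Carrier
      hb = headExpansion q b D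
      negate : ∀ x y r → (x + - y) + - r ≈ - ((y + - x) + r)
      negate x y r = trans (+-congʳ (sym (⁻¹-anti-homo‿- y x))) (-‿+-comm _ _)

    tailExpansion-antisym : ∀ q a b D → D Preserves _≗_ ⟶ _≈_ →
                            tailExpansion q a b D ≈ - tailExpansion q b a D
    tailExpansion-antisym zero    a b D D-resp =
      trans (tailExpansion-zero a b D) (sym (trans (-‿cong (tailExpansion-zero b a D)) -0#≈0#))
    tailExpansion-antisym (suc q) a b D D-resp = begin
      tailExpansion (suc q) a b D                           ≈⟨ tailExpansion-suc q a b D D-resp ⟩
      doubleExpansion q (a ∘ suc) (b ∘ suc) (D ∘ lift 1)    ≈⟨ doubleExpansion-antisym q _ _ _ (lift-resp D D-resp) ⟩
      - doubleExpansion q (b ∘ suc) (a ∘ suc) (D ∘ lift 1)  ≈⟨ -‿cong (sym (tailExpansion-suc q b a D D-resp)) ⟩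
      - tailExpansion (suc q) b a D                         ∎

  mutual
    doubleExpansion-diag : ∀ q a D → D Preserves _≗_ ⟶ _≈_ → doubleExpansion q a a D ≈ 0#
    doubleExpansion-diag q a D D-resp = begin
      doubleExpansion q a a D                                    ≈⟨ doubleExpansion-split q a a D ⟩
      (a zero * ha + - (a zero * ha)) + tailExpansion q a a D    ≈⟨ +-cong (-‿inverseʳ _) (tailExpansion-diag q a D D-resp) ⟩
      0# + 0#                                                    ≈⟨ +-identityʳ 0# ⟩
      0#                                                         ∎
      where
      ha : Carrier
      ha = headExpansion q a D

    tailExpansion-diag : ∀ q a D → D Preserves _≗_ ⟶ _≈_ → tailExpansion q a a D ≈ 0#
    tailExpansion-diag zero    a D D-resp = tailExpansion-zero a a D
    tailExpansion-diag (suc q) a D D-resp =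
      trans (tailExpansion-suc q a a D D-resp) (doubleExpansion-diag q (a ∘ suc) (D ∘ lift 1) (lift-resp D D-resp))

  swap₀₁ : ∀ {n} → Fin (suc (suc n)) → Fin (suc (suc n))
  swap₀₁ zero          = suc zero
  swap₀₁ (suc zero)    = zero
  swap₀₁ (suc (suc j)) = suc (suc j)

  module _ {q} (N : Matrix (suc (suc q)) (suc (suc q))) where
    private
      D : Minors q
      D ρ = det q (λ i j → N (ρ i) (suc (suc j)))

      D-resp : D Preserves _≗_ ⟶ _≈_
      D-resp ρ≗σ = det-cong q (λ i j → reflexive (≡.cong (λ r → N r (suc (suc j))) (ρ≗σ i)))

    det-swap₀₁ : det (suc (suc q)) (λ i j → N i (swap₀₁ j)) ≈ - det (suc (suc q)) N
    det-swap₀₁ = doubleExpansion-antisym q (λ k → N k (suc zero)) (λ k → N k zero) D D-resp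

    det-equalColumns₀₁ : (∀ k → N k zero ≈ N k (suc zero)) → det (suc (suc q)) N ≈ 0#
    det-equalColumns₀₁ N₀≈N₁ = trans (det-cong (suc (suc q)) N≈N′) (doubleExpansion-diag q (λ k → N k zero) D D-resp)
      where
      N′ : Matrix (suc (suc q)) (suc (suc q))
      N′ i zero          = N i zero
      N′ i (suc zero)    = N i zero
      N′ i (suc (suc j)) = N i (suc (suc j))
      N≈N′ : ∀ i j → N i j ≈ N′ i j
      N≈N′ i zero          = refl
      N≈N′ i (suc zero)    = sym (N₀≈N₁ i)
      N≈N′ i (suc (suc j)) = refl

  -- Swapping the first two columns turns equal columns 0 and m + 2 into equal columns 1 and m + 2,
  -- i.e. into equal columns 0 and m + 1 of every minor.
  det-equalColumns : ∀ p (m : Fin p) (N : Matrix (suc p) (suc p)) →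
                     (∀ k → N k zero ≈ N k (suc m)) → det (suc p) N ≈ 0#
  det-equalColumns (suc q) zero    N N₀≈Nₘ = det-equalColumns₀₁ N N₀≈Nₘ
  det-equalColumns (suc q) (suc m) N N₀≈Nₘ = begin
    det (suc (suc q)) N                           ≈⟨ sym (-‿involutive _) ⟩
    - - det (suc (suc q)) N                       ≈⟨ -‿cong (sym (det-swap₀₁ N)) ⟩
    - det (suc (suc q)) N′                        ≈⟨ -‿cong (∑-zero λ k → trans (*-congˡ (minor≈0 k)) (zeroʳ _)) ⟩
    - 0#                                          ≈⟨ -0#≈0# ⟩
    0#                                            ∎
    where
    N′ : Matrix (suc (suc q)) (suc (suc q))
    N′ i j = N i (swap₀₁ j)
    minor≈0 : ∀ k → det (suc q) (minor k N′) ≈ 0#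
    minor≈0 k = det-equalColumns q m (minor k N′) (λ i → N₀≈Nₘ (punchIn k i))

  cofactor : ∀ {n} → Fin (suc n) → Matrix (suc n) (suc n) → Carrier
  cofactor {n} k M = sign k * det n (minor k M)

  det-expansion : ∀ n (M : Matrix (suc n) (suc n)) → det (suc n) M ≈ ∑ (suc n) (λ k → cofactor k M * M k zero)
  det-expansion n M = ∑-cong λ k → xy∙z≈xz∙y _ _ _

  cofactor-orthogonal : ∀ n (M : Matrix (suc n) (suc n)) (m : Fin n) →
                        ∑ (suc n) (λ k → cofactor k M * M k (suc m)) ≈ 0#
  cofactor-orthogonal n M m = trans (∑-cong λ k → sym (xy∙z≈xz∙y _ _ _)) (det-equalColumns n m M′ λ k → refl)
    where
    M′ : Matrix (suc n) (suc n)
    M′ i zero    = M i (suc m)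
    M′ i (suc j) = M i (suc j)

module InvertibleMatrices {c ℓ} (F : Field0 c ℓ) where
  open Field0 F hiding (zero)
  open MatrixDefs F using (I)
  open Matrices commutativeRing
  open import Algebra.Properties.Ring ring using (-0#≈0#; -‿involutive; x∙y⁻¹≈ε⇒x≈y)
  open import Algebra.Properties.CommutativeSemigroup *-commutativeSemigroup using (x∙yz≈y∙xz)
  open import Algebra.Solver.CommutativeMonoid *-commutativeMonoid using (solve; _⊕_; _⊜_)
  open import Relation.Binary.Reasoning.Setoid setoid

  1≉0 : ¬ 1# ≈ 0#
  1≉0 1≈0 = charZero 0 (trans (+-identityʳ 1#) 1≈0)

  inverseˡ : ∀ x (x≉0 : ¬ x ≈ 0#) → inv x x≉0 * x ≈ 1#
  inverseˡ x x≉0 = trans (*-comm _ _) (inverseʳ x x≉0)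

  *-cancelˡ : ∀ {x y z} → ¬ x ≈ 0# → x * y ≈ x * z → y ≈ z
  *-cancelˡ {x} {y} {z} x≉0 xy≈xz = begin
    y                    ≈⟨ sym (*-identityˡ y) ⟩
    1# * y               ≈⟨ *-congʳ (sym (inverseˡ x x≉0)) ⟩
    inv x x≉0 * x * y    ≈⟨ *-assoc _ _ _ ⟩
    inv x x≉0 * (x * y)  ≈⟨ *-congˡ xy≈xz ⟩
    inv x x≉0 * (x * z)  ≈⟨ sym (*-assoc _ _ _) ⟩
    inv x x≉0 * x * z    ≈⟨ *-congʳ (inverseˡ x x≉0) ⟩
    1# * z               ≈⟨ *-identityˡ z ⟩
    z                    ∎

  x*y≉0 : ∀ {x y} → ¬ x ≈ 0# → ¬ y ≈ 0# → ¬ x * y ≈ 0#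
  x*y≉0 x≉0 y≉0 xy≈0 = y≉0 (*-cancelˡ x≉0 (trans xy≈0 (sym (zeroʳ _))))

  sign≉0 : ∀ {n} (k : Fin n) → ¬ sign k ≈ 0#
  sign≉0 zero    = 1≉0
  sign≉0 (suc k) -s≈0 = sign≉0 k (trans (sym (-‿involutive _)) (trans (-‿cong -s≈0) -0#≈0#))

  I-diag : ∀ {n} (i : Fin n) → I i i ≈ 1#
  I-diag i with i ≟ i
  ... | yes _  = refl
  ... | no i≢i = ⊥-elim (i≢i ≡.refl)

  I-off : ∀ {n} {i j : Fin n} → i ≢ j → I i j ≈ 0#
  I-off {i = i} {j} i≢j with i ≟ j
  ... | yes i≡j = ⊥-elim (i≢j i≡j)
  ... | no _    = refl

  ∑-*I : ∀ {n} (f : Fin n → Carrier) i → ∑ n (λ k → f k * I k i) ≈ f i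
  ∑-*I f i = trans (∑-single i _ (λ k k≢i → trans (*-congˡ (I-off k≢i)) (zeroʳ _)))
                   (trans (*-congˡ (I-diag i)) (*-identityʳ _))

  ∑-I* : ∀ {n} i (f : Fin n → Carrier) → ∑ n (λ k → I i k * f k) ≈ f i
  ∑-I* i f = trans (∑-single i _ (λ k k≢i → trans (*-congʳ (I-off (k≢i ∘ ≡.sym))) (zeroˡ _)))
                   (trans (*-congʳ (I-diag i)) (*-identityˡ _))

  I-punchIn : ∀ {n} (i : Fin (suc n)) (r r′ : Fin n) → I (punchIn i r) (punchIn i r′) ≈ I r r′
  I-punchIn i r r′ = by-cases (r ≟ r′)
    where
    by-cases : Dec (r ≡ r′) → I (punchIn i r) (punchIn i r′) ≈ I r r′
    by-cases (yes ≡.refl) = trans (I-diag (punchIn i r)) (sym (I-diag r))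
    by-cases (no r≢r′)    = trans (I-off (r≢r′ ∘ punchIn-injective i r r′)) (sym (I-off r≢r′))

  infixl 7 _⋆_
  _⋆_ : ∀ {m k p} → Matrix m k → Matrix k p → Matrix m p
  (X ⋆ Y) i j = ∑ _ (λ l → X i l * Y l j)

  ⋆-assoc : ∀ {m k p q} (X : Matrix m k) (Y : Matrix k p) (Z : Matrix p q) i j →
            ((X ⋆ Y) ⋆ Z) i j ≈ (X ⋆ (Y ⋆ Z)) i j
  ⋆-assoc X Y Z i j = begin
    ∑ _ (λ l → ∑ _ (λ t → X i t * Y t l) * Z l j)     ≈⟨ ∑-cong (λ l → *-distribʳ-∑ (Z l j) _) ⟩
    ∑ _ (λ l → ∑ _ (λ t → X i t * Y t l * Z l j))     ≈⟨ ∑-comm _ ⟩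
    ∑ _ (λ t → ∑ _ (λ l → X i t * Y t l * Z l j))     ≈⟨ ∑-cong (λ t → ∑-cong (λ l → *-assoc _ _ _)) ⟩
    ∑ _ (λ t → ∑ _ (λ l → X i t * (Y t l * Z l j)))   ≈⟨ ∑-cong (λ t → sym (*-distribˡ-∑ (X i t) _)) ⟩
    ∑ _ (λ t → X i t * ∑ _ (λ l → Y t l * Z l j))     ∎

  RightInverse : ∀ {n} → Matrix n n → Matrix n n → Set ℓ
  RightInverse X Y = ∀ i j → (X ⋆ Y) i j ≈ I i j

  ⋆-cancelʳ : ∀ {n} {U V W W′ : Matrix n n} → RightInverse W W′ →
              (∀ i j → (U ⋆ W) i j ≈ (V ⋆ W) i j) → ∀ i j → U i j ≈ V i j
  ⋆-cancelʳ {U = U} {V} {W} {W′} WW′≈I UW≈VW i j = begin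
    U i j               ≈⟨ sym (through U) ⟩
    ((U ⋆ W) ⋆ W′) i j  ≈⟨ ∑-cong (λ l → *-congʳ (UW≈VW i l)) ⟩
    ((V ⋆ W) ⋆ W′) i j  ≈⟨ through V ⟩
    V i j               ∎
    where
    through : ∀ X → ((X ⋆ W) ⋆ W′) i j ≈ X i j
    through X = trans (⋆-assoc X W W′ i j) (trans (∑-cong (λ l → *-congˡ (WW′≈I l j))) (∑-*I (X i) j))

  cofactor-column : ∀ n (X : Matrix (suc n) (suc n)) m →
                    ∑ (suc n) (λ k → cofactor k X * X k m) ≈ det (suc n) X * I zero m
  cofactor-column n X zero    =
    trans (sym (det-expansion n X)) (sym (trans (*-congˡ (I-diag {suc n} zero)) (*-identityʳ _)))
  cofactor-column n X (suc m) =
    trans (cofactor-orthogonal n X m) (sym (trans (*-congˡ (I-off {i = zero} {suc m} (λ ()))) (zeroʳ _)))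

  det≉0⇒kernelHead≈0 : ∀ n (X : Matrix (suc n) (suc n)) (v : Fin (suc n) → Carrier) → ¬ det (suc n) X ≈ 0# →
                       (∀ k → ∑ (suc n) (λ m → X k m * v m) ≈ 0#) → v zero ≈ 0#
  det≉0⇒kernelHead≈0 n X v det≉0 Xv≈0 = *-cancelˡ det≉0 (begin
    det (suc n) X * v zero                              ≈⟨ *-congˡ (sym (∑-I* zero v)) ⟩
    det (suc n) X * ∑ _ (λ m → I zero m * v m)          ≈⟨ *-distribˡ-∑ _ _ ⟩
    ∑ _ (λ m → det (suc n) X * (I zero m * v m))
      ≈⟨ ∑-cong (λ m → trans (sym (*-assoc _ _ _)) (*-congʳ (sym (cofactor-column n X m)))) ⟩
    ((cofactors ⋆ X) ⋆ column) zero zero                ≈⟨ ⋆-assoc cofactors X column zero zero ⟩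
    ∑ _ (λ k → cofactor k X * ∑ _ (λ m → X k m * v m))
      ≈⟨ ∑-zero (λ k → trans (*-congˡ (Xv≈0 k)) (zeroʳ _)) ⟩
    0#                                                  ≈⟨ sym (zeroʳ _) ⟩
    det (suc n) X * 0#                                  ∎)
    where
    cofactors : Matrix 1 (suc n)
    cofactors _ k = cofactor k X
    column : Matrix (suc n) 1
    column m _ = v m

  module _ {n} (X Y : Matrix (suc n) (suc n)) (XY≈I : RightInverse X Y) where
    private
      move : ∀ {a b d} → a + b ≈ d → b ≈ d + - a
      move {a} {b} {d} a+b≈d = begin
        b              ≈⟨ sym (+-identityʳ b) ⟩
        b + 0#         ≈⟨ +-congˡ (sym (-‿inverseʳ a)) ⟩
        b + (a + - a)  ≈⟨ sym (+-assoc _ _ _) ⟩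
        b + a + - a    ≈⟨ +-congʳ (trans (+-comm b a) a+b≈d) ⟩
        d + - a        ∎

      tail-product : ∀ a b → ∑ n (λ j → X a (suc j) * Y (suc j) b) ≈ I a b + - (X a zero * Y zero b)
      tail-product a b = move (trans (sym (∑-suc _)) (XY≈I a b))

    minorInverse : Fin (suc n) → Carrier → Matrix n n
    minorInverse i κ r r′ = Y (suc r) (punchIn i r′) + - (κ * Y zero (punchIn i r′) * Y (suc r) i)

    -- Deleting the first column x of X and the first row y of Y turns XY = I into X′Y′ = I - x yᵀ;
    -- the correction term in minorInverse cancels x yᵀ on the rows of minor i X.
    minor-rightInverse : ∀ i κ → (∀ r → Y zero i * κ * Y zero (punchIn i r) ≈ Y zero (punchIn i r)) →
                         RightInverse (minor i X) (minorInverse i κ)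
    minor-rightInverse i κ absorbs r r′ = begin
      ∑ n (λ j → X a (suc j) * (Y (suc j) b + - (κ * y b * Y (suc j) i)))
        ≈⟨ ∑-*-sub _ _ _ ⟩
      ∑ n (λ j → X a (suc j) * Y (suc j) b) + - ∑ n (λ j → X a (suc j) * (κ * y b * Y (suc j) i))
        ≈⟨ +-cong (tail-product a b) (-‿cong (trans (∑-cong (λ j → x∙yz≈y∙xz _ _ _)) (sym (*-distribˡ-∑ _ _)))) ⟩
      (I a b + - (X a zero * y b)) + - (κ * y b * ∑ n (λ j → X a (suc j) * Y (suc j) i))
        ≈⟨ +-cong (+-congʳ (I-punchIn i r r′))
                  (-‿cong (*-congˡ (trans (tail-product a i) (+-congʳ (I-off (punchInᵢ≢i i r)))))) ⟩
      (I r r′ + - (X a zero * y b)) + - (κ * y b * (0# + - (X a zero * y i)))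
        ≈⟨ +-congˡ correction ⟩
      (I r r′ + - (X a zero * y b)) + X a zero * y b
        ≈⟨ trans (+-assoc _ _ _) (trans (+-congˡ (-‿inverseˡ _)) (+-identityʳ _)) ⟩
      I r r′ ∎
      where
      a : Fin (suc n)
      a = punchIn i r
      b : Fin (suc n)
      b = punchIn i r′
      y : Fin (suc n) → Carrier
      y = Y zero
      correction : - (κ * y b * (0# + - (X a zero * y i))) ≈ X a zero * y b
      correction = begin
        - (κ * y b * (0# + - (X a zero * y i)))  ≈⟨ -‿cong (trans (*-congˡ (+-identityˡ _)) (*-‿comm _ _)) ⟩
        - - (κ * y b * (X a zero * y i))         ≈⟨ -‿involutive _ ⟩
        κ * y b * (X a zero * y i)
          ≈⟨ solve 4 (λ k u x v → (k ⊕ u) ⊕ (x ⊕ v) ⊜ x ⊕ ((v ⊕ k) ⊕ u)) refl _ _ _ _ ⟩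
        X a zero * (y i * κ * y b)               ≈⟨ *-congˡ (absorbs r′) ⟩
        X a zero * y b                           ∎

  -- If det X ≈ 0 the cofactor row annihilates X, so it vanishes (it equals (cofactors ⋆ X) ⋆ Y) and
  -- every minor is singular. But some minor has a right inverse: minor i X if the entry Y 0 i is invertible,
  -- minor 0 X if the row Y 0 vanishes. Deciding between the two is classical, which is harmless
  -- since the goal is a negation.
  rightInverse⇒det≉0 : ∀ n (X Y : Matrix n n) → RightInverse X Y → ¬ det n X ≈ 0#
  rightInverse⇒det≉0 zero    X Y XY≈I = 1≉0
  rightInverse⇒det≉0 (suc n) X Y XY≈I det≈0 = sequence (RawMonad.rawApplicative ¬¬-Monad) pivot zeroRow
    where
    cofactors : Matrix 1 (suc n)
    cofactors _ k = cofactor k X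

    cofactors⋆X≈0 : ∀ l → (cofactors ⋆ X) zero l ≈ 0#
    cofactors⋆X≈0 l = trans (cofactor-column n X l) (trans (*-congʳ det≈0) (zeroˡ _))

    cofactor≈0 : ∀ k → cofactor k X ≈ 0#
    cofactor≈0 k = begin
      cofactor k X                                ≈⟨ sym (∑-*I (λ m → cofactor m X) k) ⟩
      ∑ _ (λ m → cofactor m X * I m k)            ≈⟨ ∑-cong (λ m → *-congˡ (sym (XY≈I m k))) ⟩
      (cofactors ⋆ (X ⋆ Y)) zero k                ≈⟨ sym (⋆-assoc cofactors X Y zero k) ⟩
      ∑ _ (λ l → (cofactors ⋆ X) zero l * Y l k)
        ≈⟨ ∑-zero (λ l → trans (*-congʳ (cofactors⋆X≈0 l)) (zeroˡ _)) ⟩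
      0#                                          ∎

    minor≈0 : ∀ k → det n (minor k X) ≈ 0#
    minor≈0 k = *-cancelˡ (sign≉0 k) (trans (cofactor≈0 k) (sym (zeroʳ _)))

    pivot : ∀ i → ¬ ¬ Y zero i ≈ 0#
    pivot i yᵢ≉0 = rightInverse⇒det≉0 n (minor i X) _ (minor-rightInverse X Y XY≈I i κ absorbs) (minor≈0 i)
      where
      κ : Carrier
      κ = inv (Y zero i) yᵢ≉0
      absorbs : ∀ r → Y zero i * κ * Y zero (punchIn i r) ≈ Y zero (punchIn i r)
      absorbs r = trans (*-congʳ (inverseʳ _ yᵢ≉0)) (*-identityˡ _)

    zeroRow : ¬ (∀ i → Y zero i ≈ 0#)
    zeroRow y≈0 =
      rightInverse⇒det≉0 n (minor zero X) _ (minor-rightInverse X Y XY≈I zero 0# absorbs) (minor≈0 zero)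
      where
      absorbs : ∀ r → Y zero zero * 0# * Y zero (suc r) ≈ Y zero (suc r)
      absorbs r = trans (*-congʳ (zeroʳ _)) (trans (zeroˡ _) (sym (y≈0 (suc r))))

  -- Transposing the columns 0 and j brings the entry v j to the front.
  rightInverse⇒trivialKernel : ∀ n (X Y : Matrix n n) → RightInverse X Y → (v : Fin n → Carrier) →
                               (∀ k → ∑ n (λ m → X k m * v m) ≈ 0#) → ∀ j → v j ≈ 0#
  rightInverse⇒trivialKernel (suc n) X Y XY≈I v Xv≈0 j =
    det≉0⇒kernelHead≈0 n Xτ (v ∘ τ) (rightInverse⇒det≉0 (suc n) Xτ τY XττY≈I)
                        (λ k → trans (sym (∑-permute _ π)) (Xv≈0 k))
    where
    π : Permutation′ (suc n)
    π = Perm.transpose zero j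
    τ : Fin (suc n) → Fin (suc n)
    τ = π ⟨$⟩ʳ_
    Xτ : Matrix (suc n) (suc n)
    Xτ k m = X k (τ m)
    τY : Matrix (suc n) (suc n)
    τY m l = Y (τ m) l
    XττY≈I : RightInverse Xτ τY
    XττY≈I k l = trans (sym (∑-permute _ π)) (XY≈I k l)

  rightInverse-sym : ∀ n (X Y : Matrix n n) → RightInverse X Y → RightInverse Y X
  rightInverse-sym n X Y XY≈I m l = x∙y⁻¹≈ε⇒x≈y _ _ (rightInverse⇒trivialKernel n X Y XY≈I v Xv≈0 m)
    where
    v : Fin n → Carrier
    v m′ = (Y ⋆ X) m′ l + - I m′ l
    Xv≈0 : ∀ k → ∑ n (λ m′ → X k m′ * v m′) ≈ 0#
    Xv≈0 k = begin
      ∑ n (λ m′ → X k m′ * v m′)                          ≈⟨ ∑-*-sub _ _ _ ⟩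
      (X ⋆ (Y ⋆ X)) k l + - ∑ n (λ m′ → X k m′ * I m′ l)
        ≈⟨ +-cong (sym (⋆-assoc X Y X k l)) (-‿cong (∑-*I (X k) l)) ⟩
      ((X ⋆ Y) ⋆ X) k l + - X k l
        ≈⟨ +-congʳ (trans (∑-cong (λ m′ → *-congʳ (XY≈I k m′))) (∑-I* k (λ m′ → X m′ l))) ⟩
      X k l + - X k l                                     ≈⟨ -‿inverseʳ _ ⟩
      0#                                                  ∎

module TypeIIEquivalences {c ℓ} (F : Field0 c ℓ) where
  open Field0 F hiding (zero)
  open MatrixDefs F
  open Matrices commutativeRing
  open InvertibleMatrices F
  open import Algebra.Properties.CommutativeSemigroup *-commutativeSemigroup using (x∙yz≈y∙xz; x∙yz≈z∙yx; x∙yz≈yx∙z)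
  open import Algebra.Solver.CommutativeMonoid *-commutativeMonoid using (solve; _⊕_; _⊜_)
  open import Relation.Binary.Reasoning.Setoid setoid

  Σᶠ≈∑ : ∀ n (f : Fin n → Carrier) → Σᶠ n f ≈ ∑ n f
  Σᶠ≈∑ zero    f = sym (∑-empty f)
  Σᶠ≈∑ (suc n) f = trans (+-congˡ (Σᶠ≈∑ n (λ i → f (suc i)))) (sym (∑-suc f))

  EigenEquations : ∀ {n} (A B R S : Mat n) → Set ℓ
  EigenEquations {n} A B R S = ∀ i j k → ∑ n (λ p → R k p * col∘ A B i j p) ≈ S i j * col∘ A B i j k

  inN⇔eigen : ∀ {n} {A B R S : Mat n} → NoZeroEntry A → NoZeroEntry B →
              Σ (InN A B R) (λ p → S ≈ᴹ Θ A B R p) ⇔ EigenEquations A B R S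
  inN⇔eigen {n} {A} {B} {R} {S} A≉0 B≉0 = mk⇔ to from
    where
    to : Σ (InN A B R) (λ p → S ≈ᴹ Θ A B R p) → EigenEquations A B R S
    to (eigen , S≈Θ) i j k =
      trans (sym (Σᶠ≈∑ n _)) (trans (proj₂ (proj₂ (eigen i j)) k) (*-congʳ (sym (S≈Θ i j))))
    from : EigenEquations A B R S → Σ (InN A B R) (λ p → S ≈ᴹ Θ A B R p)
    from eq = (λ i j → (λ v≈0 → x*y≉0 (A≉0 i i) (B≉0 i j) (v≈0 i))
                     , S i j
                     , λ k → trans (Σᶠ≈∑ n _) (eq i j k))
            , λ i j → refl

  eigen-swap : ∀ {n} {A B R S : Mat n} → EigenEquations A B R S → EigenEquations B A R (S ᵀ)
  eigen-swap eq i j k = trans (∑-cong (λ p → *-congˡ (*-comm _ _))) (trans (eq j i k) (*-congˡ (*-comm _ _)))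

  eigen⇔eigen-swap : ∀ {n} {A B R S : Mat n} → EigenEquations A B R S ⇔ EigenEquations B A R (S ᵀ)
  eigen⇔eigen-swap = mk⇔ eigen-swap eigen-swap

  Columnwise : ∀ {n} → Op n → (Fin n → Fin n → Fin n → Carrier) → Set (c ⊔ ℓ)
  Columnwise {n} Φ φ = ∀ M i j → Φ M i j ≈ ∑ n (λ m → φ i j m * M m j)

  XΔX-columnwise : ∀ {n} (C D E : Mat n) →
                   Columnwise (Xₒ C ⊚ (Δₒ D ⊚ Xₒ E)) (λ i j m → ∑ n (λ k → C i k * (E k m * D k j)))
  XΔX-columnwise {n} C D E M i j = begin
    Σᶠ n (λ k → C i k * (D k j * Σᶠ n (λ m → E k m * M m j)))
      ≈⟨ trans (Σᶠ≈∑ n _) (∑-cong (λ k → *-congˡ (*-congˡ (Σᶠ≈∑ n _)))) ⟩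
    ∑ n (λ k → C i k * (D k j * ∑ n (λ m → E k m * M m j)))
      ≈⟨ ∑-cong (λ k → trans (*-congˡ (*-distribˡ-∑ _ _)) (*-distribˡ-∑ _ _)) ⟩
    ∑ n (λ k → ∑ n (λ m → C i k * (D k j * (E k m * M m j))))
      ≈⟨ ∑-comm _ ⟩
    ∑ n (λ m → ∑ n (λ k → C i k * (D k j * (E k m * M m j))))
      ≈⟨ ∑-cong (λ m → trans (∑-cong (λ k → rearrange _ _ _ _)) (sym (*-distribʳ-∑ _ _))) ⟩
    ∑ n (λ m → ∑ n (λ k → C i k * (E k m * D k j)) * M m j) ∎
    where
    rearrange : ∀ c d e x → c * (d * (e * x)) ≈ c * (e * d) * x
    rearrange = solve 4 (λ c d e x → c ⊕ (d ⊕ (e ⊕ x)) ⊜ (c ⊕ (e ⊕ d)) ⊕ x) refl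

  ΔXΔ-columnwise : ∀ {n} (D C E : Mat n) → Columnwise (Δₒ D ⊚ (Xₒ C ⊚ Δₒ E)) (λ i j m → D i j * (C i m * E m j))
  ΔXΔ-columnwise {n} D C E M i j = begin
    D i j * Σᶠ n (λ m → C i m * (E m j * M m j))   ≈⟨ *-congˡ (Σᶠ≈∑ n _) ⟩
    D i j * ∑ n (λ m → C i m * (E m j * M m j))    ≈⟨ *-distribˡ-∑ _ _ ⟩
    ∑ n (λ m → D i j * (C i m * (E m j * M m j)))  ≈⟨ ∑-cong (λ m → rearrange _ _ _ _) ⟩
    ∑ n (λ m → D i j * (C i m * E m j) * M m j)    ∎
    where
    rearrange : ∀ d c e x → d * (c * (e * x)) ≈ d * (c * e) * x
    rearrange = solve 4 (λ d c e x → d ⊕ (c ⊕ (e ⊕ x)) ⊜ (d ⊕ (c ⊕ e)) ⊕ x) refl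

  ≈ᴼ⇔≈coefficients : ∀ {n} {Φ Ψ : Op n} {φ ψ} → Columnwise Φ φ → Columnwise Ψ ψ →
                     (Φ ≈ᴼ Ψ) ⇔ (∀ i j m → φ i j m ≈ ψ i j m)
  ≈ᴼ⇔≈coefficients {n} {Φ} {Ψ} {φ} {ψ} Φ-columnwise Ψ-columnwise = mk⇔ to from
    where
    unit : Fin n → Mat n
    unit m₀ m _ = I m m₀
    to : Φ ≈ᴼ Ψ → ∀ i j m → φ i j m ≈ ψ i j m
    to Φ≈Ψ i j m₀ = begin
      φ i j m₀                      ≈⟨ sym (∑-*I (φ i j) m₀) ⟩
      ∑ n (λ m → φ i j m * I m m₀)  ≈⟨ sym (Φ-columnwise (unit m₀) i j) ⟩
      Φ (unit m₀) i j               ≈⟨ Φ≈Ψ (unit m₀) i j ⟩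
      Ψ (unit m₀) i j               ≈⟨ Ψ-columnwise (unit m₀) i j ⟩
      ∑ n (λ m → ψ i j m * I m m₀)  ≈⟨ ∑-*I (ψ i j) m₀ ⟩
      ψ i j m₀                      ∎
    from : (∀ i j m → φ i j m ≈ ψ i j m) → Φ ≈ᴼ Ψ
    from φ≈ψ M i j =
      trans (Φ-columnwise M i j) (trans (∑-cong (λ m → *-congʳ (φ≈ψ i j m))) (sym (Ψ-columnwise M i j)))

  eigen⇔XΔX≈ΔXΔ : ∀ {n} {A B R S : Mat n} →
                  EigenEquations A B R S ⇔ ((Xₒ R ⊚ (Δₒ B ⊚ Xₒ A)) ≈ᴼ (Δₒ B ⊚ (Xₒ A ⊚ Δₒ S)))
  eigen⇔XΔX≈ΔXΔ {n} {A} {B} {R} {S} =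
    ⇔-trans (mk⇔ (λ eq i j m → trans (eq m j i) (x∙yz≈z∙yx _ _ _))
                 (λ eq m j i → trans (eq i j m) (x∙yz≈z∙yx _ _ _)))
            (⇔-sym (≈ᴼ⇔≈coefficients (XΔX-columnwise R B A) (ΔXΔ-columnwise B A S)))

  typeII-∑ : ∀ {n} {A : Mat n} (tA : TypeII A) i j →
             ∑ n (λ k → A i k * schurInv A (TypeII.noZero tA) j k) ≈ ι n * I i j
  typeII-∑ {n} tA i j = trans (sym (Σᶠ≈∑ n _)) (TypeII.typeII tA i j)

  typeII-rightInverseᵀ : ∀ {n} {A : Mat (suc n)} (tA : TypeII A) →
                         RightInverse (schurInv A (TypeII.noZero tA) ᵀ) (inv (ι (suc n)) (charZero n) ⊙ A)
  typeII-rightInverseᵀ {n} {A} tA k i = begin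
    ∑ _ (λ l → A⁻ l k * (κ * A l i))  ≈⟨ ∑-cong (λ l → x∙yz≈yx∙z _ _ _) ⟩
    ∑ _ (λ l → κ * A⁻ l k * A l i)    ≈⟨ rightInverse-sym _ A (κ ⊙ (A⁻ ᵀ)) A⋆κA⁻ᵀ≈I k i ⟩
    I k i                             ∎
    where
    A⁻ : Mat (suc n)
    A⁻ = schurInv A (TypeII.noZero tA)
    κ : Carrier
    κ = inv (ι (suc n)) (charZero n)
    A⋆κA⁻ᵀ≈I : RightInverse A (κ ⊙ (A⁻ ᵀ))
    A⋆κA⁻ᵀ≈I i j = begin
      ∑ _ (λ k → A i k * (κ * A⁻ j k))  ≈⟨ ∑-cong (λ k → x∙yz≈y∙xz _ _ _) ⟩
      ∑ _ (λ k → κ * (A i k * A⁻ j k))  ≈⟨ sym (*-distribˡ-∑ κ _) ⟩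
      κ * ∑ _ (λ k → A i k * A⁻ j k)    ≈⟨ *-congˡ (typeII-∑ tA i j) ⟩
      κ * (ι (suc n) * I i j)           ≈⟨ sym (*-assoc _ _ _) ⟩
      κ * ι (suc n) * I i j             ≈⟨ *-congʳ (inverseˡ _ _) ⟩
      1# * I i j                        ≈⟨ *-identityˡ _ ⟩
      I i j                             ∎

  typeII-cancelʳ : ∀ {n} {A : Mat n} (tA : TypeII A) {U V : Mat n} →
                   let A⁻ = schurInv A (TypeII.noZero tA) in
                   (∀ i j → (U ⋆ (A⁻ ᵀ)) i j ≈ (V ⋆ (A⁻ ᵀ)) i j) → ∀ i j → U i j ≈ V i j
  typeII-cancelʳ {zero}  tA _ ()
  typeII-cancelʳ {suc n} tA = ⋆-cancelʳ (typeII-rightInverseᵀ tA)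

  -- With Dᵢ the diagonal matrix with diagonal B e_i, the equations for fixed i say that
  -- n Dᵢ⁻¹ R Dᵢ = A diag(S e_i) A⁻ᵀ, i.e. (as A⁻ᵀ = n A⁻¹) that Dᵢ A diagonalises R with eigenvalues S e_i.
  DiagonalisationEquations : ∀ {n} (A A⁻ B B⁻ R S : Mat n) → Set ℓ
  DiagonalisationEquations {n} A A⁻ B B⁻ R S =
    ∀ i j m → B j i * (B⁻ m i * (ι n * R m j)) ≈ ∑ n (λ k → S k i * (A m k * A⁻ j k))

  module _ {n} {A B R S : Mat n} (tA : TypeII A) (B≉0 : NoZeroEntry B) where
    private
      A⁻ : Mat n
      A⁻ = schurInv A (TypeII.noZero tA)
      B⁻ : Mat n
      B⁻ = schurInv B B≉0

      -- U c ≈ V c are the eigen-equations for the vectors A e_i ∘ B e_c, one per column i.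
      U V : Fin n → Mat n
      U c k i = ∑ n (λ p → R k p * col∘ A B i c p)
      V c k i = S i c * col∘ A B i c k

      U⋆A⁻ᵀ : ∀ c m j → (U c ⋆ (A⁻ ᵀ)) m j ≈ ι n * (R m j * B j c)
      U⋆A⁻ᵀ c m j = begin
        ∑ n (λ k → ∑ n (λ p → R m p * (A p k * B p c)) * A⁻ j k)  ≈⟨ ∑-cong (λ k → *-distribʳ-∑ _ _) ⟩
        ∑ n (λ k → ∑ n (λ p → R m p * (A p k * B p c) * A⁻ j k))  ≈⟨ ∑-comm _ ⟩
        ∑ n (λ p → ∑ n (λ k → R m p * (A p k * B p c) * A⁻ j k))
          ≈⟨ ∑-cong (λ p → trans (∑-cong (λ k → rearrange _ _ _ _)) (sym (*-distribˡ-∑ _ _))) ⟩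
        ∑ n (λ p → R m p * B p c * ∑ n (λ k → A p k * A⁻ j k))    ≈⟨ ∑-cong (λ p → *-congˡ (typeII-∑ tA p j)) ⟩
        ∑ n (λ p → R m p * B p c * (ι n * I p j))                 ≈⟨ ∑-cong (λ p → x∙yz≈yx∙z _ _ _) ⟩
        ∑ n (λ p → ι n * (R m p * B p c) * I p j)                 ≈⟨ ∑-*I (λ p → ι n * (R m p * B p c)) j ⟩
        ι n * (R m j * B j c)                                     ∎
        where
        rearrange : ∀ r a b a⁻ → r * (a * b) * a⁻ ≈ r * b * (a * a⁻)
        rearrange = solve 4 (λ r a b a⁻ → (r ⊕ (a ⊕ b)) ⊕ a⁻ ⊜ (r ⊕ b) ⊕ (a ⊕ a⁻)) refl

      V⋆A⁻ᵀ : ∀ c m j → (V c ⋆ (A⁻ ᵀ)) m j ≈ B m c * ∑ n (λ k → S k c * (A m k * A⁻ j k))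
      V⋆A⁻ᵀ c m j = trans (∑-cong (λ k → rearrange _ _ _ _)) (sym (*-distribˡ-∑ _ _))
        where
        rearrange : ∀ s a b a⁻ → s * (a * b) * a⁻ ≈ b * (s * (a * a⁻))
        rearrange = solve 4 (λ s a b a⁻ → (s ⊕ (a ⊕ b)) ⊕ a⁻ ⊜ b ⊕ (s ⊕ (a ⊕ a⁻))) refl

      B*lhs : ∀ c m j → B m c * (B j c * (B⁻ m c * (ι n * R m j))) ≈ ι n * (R m j * B j c)
      B*lhs c m j = begin
        B m c * (B j c * (B⁻ m c * (ι n * R m j)))
          ≈⟨ solve 5 (λ b b′ b⁻ ι r → b ⊕ (b′ ⊕ (b⁻ ⊕ (ι ⊕ r))) ⊜ (b ⊕ b⁻) ⊕ (ι ⊕ (r ⊕ b′)))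
                   refl _ _ _ _ _ ⟩
        B m c * B⁻ m c * (ι n * (R m j * B j c))  ≈⟨ *-congʳ (inverseʳ _ (B≉0 m c)) ⟩
        1# * (ι n * (R m j * B j c))              ≈⟨ *-identityˡ _ ⟩
        ι n * (R m j * B j c)                     ∎

      column⇔ : ∀ c m j → ((U c ⋆ (A⁻ ᵀ)) m j ≈ (V c ⋆ (A⁻ ᵀ)) m j) ⇔
                          (B j c * (B⁻ m c * (ι n * R m j)) ≈ ∑ n (λ k → S k c * (A m k * A⁻ j k)))
      column⇔ c m j = mk⇔
        (λ UW≈VW → *-cancelˡ (B≉0 m c)
          (trans (B*lhs c m j) (trans (sym (U⋆A⁻ᵀ c m j)) (trans UW≈VW (V⋆A⁻ᵀ c m j)))))
        (λ lhs≈rhs →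
          trans (U⋆A⁻ᵀ c m j) (trans (sym (B*lhs c m j)) (trans (*-congˡ lhs≈rhs) (sym (V⋆A⁻ᵀ c m j)))))

    eigen⇔diagonalisation : EigenEquations A B R S ⇔ DiagonalisationEquations A A⁻ B B⁻ R S
    eigen⇔diagonalisation = mk⇔
      (λ eq c j m → Equivalence.to (column⇔ c m j) (∑-cong (λ k → *-congʳ (eq k c m))))
      (λ diag i c k → typeII-cancelʳ tA (λ m j → Equivalence.from (column⇔ c m j) (diag c j m)) k i)

  diagonalisation⇔ΔXΔ≈XΔX : ∀ {n} {A A⁻ B B⁻ R S : Mat n} → DiagonalisationEquations A A⁻ B B⁻ R S ⇔
    ((Δₒ (B ᵀ) ⊚ (Xₒ (B⁻ ᵀ) ⊚ Δₒ (ι n ⊙ R))) ≈ᴼ (Xₒ (S ᵀ) ⊚ (Δₒ (A⁻ ᵀ) ⊚ Xₒ (A ᵀ))))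
  diagonalisation⇔ΔXΔ≈XΔX {n} {A} {A⁻} {B} {B⁻} {R} {S} =
    ⇔-sym (≈ᴼ⇔≈coefficients (ΔXΔ-columnwise (B ᵀ) (B⁻ ᵀ) (ι n ⊙ R)) (XΔX-columnwise (S ᵀ) (A⁻ ᵀ) (A ᵀ)))

  diagonalisation-swap⇔ΔXΔ≈XΔX : ∀ {n} {A A⁻ B B⁻ R S : Mat n} → DiagonalisationEquations B B⁻ A A⁻ R (S ᵀ) ⇔
    ((Δₒ (A⁻ ᵀ) ⊚ (Xₒ (A ᵀ) ⊚ Δₒ (ι n ⊙ (R ᵀ)))) ≈ᴼ (Xₒ S ⊚ (Δₒ (B ᵀ) ⊚ Xₒ (B⁻ ᵀ))))
  diagonalisation-swap⇔ΔXΔ≈XΔX {n} {A} {A⁻} {B} {B⁻} {R} {S} =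
    ⇔-trans (mk⇔ (λ diag i j m → exchange (diag i m j)) (λ eq i m j → exchange (eq i j m)))
            (⇔-sym (≈ᴼ⇔≈coefficients (ΔXΔ-columnwise (A⁻ ᵀ) (A ᵀ) (ι n ⊙ (R ᵀ)))
                                     (XΔX-columnwise S (B ᵀ) (B⁻ ᵀ))))
    where
    exchange : ∀ {x y z} {s u v : Fin n → Carrier} →
               x * (y * z) ≈ ∑ n (λ k → s k * (u k * v k)) → y * (x * z) ≈ ∑ n (λ k → s k * (v k * u k))
    exchange eq = trans (x∙yz≈y∙xz _ _ _) (trans eq (∑-cong (λ k → *-congˡ (*-comm _ _))))

theorem3p2 : ∀ {c ℓ} (F : Field0 c ℓ) (n : ℕ) →
    let open Field0 F using (ι) in
    let open MatrixDefs F in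
    (A B : Mat n) (tA : TypeII A) (tB : TypeII B) (R S : Mat n) →
    let A⁻ = schurInv A (TypeII.noZero tA) in
    let B⁻ = schurInv B (TypeII.noZero tB) in
    let a = Σ (InN A B R) (λ p → S ≈ᴹ Θ A B R p) in
    let b = (Xₒ R ⊚ (Δₒ B ⊚ Xₒ A)) ≈ᴼ (Δₒ B ⊚ (Xₒ A ⊚ Δₒ S)) in
    let c' = (Xₒ R ⊚ (Δₒ A ⊚ Xₒ B)) ≈ᴼ (Δₒ A ⊚ (Xₒ B ⊚ Δₒ (S ᵀ))) in
    let d = (Δₒ (B ᵀ) ⊚ (Xₒ (B⁻ ᵀ) ⊚ Δₒ (ι n ⊙ R))) ≈ᴼ (Xₒ (S ᵀ) ⊚ (Δₒ (A⁻ ᵀ) ⊚ Xₒ (A ᵀ))) in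
    let e = (Δₒ (A⁻ ᵀ) ⊚ (Xₒ (A ᵀ) ⊚ Δₒ (ι n ⊙ (R ᵀ)))) ≈ᴼ (Xₒ S ⊚ (Δₒ (B ᵀ) ⊚ Xₒ (B⁻ ᵀ))) in
    (a ⇔ b) × (a ⇔ c') × (a ⇔ d) × (a ⇔ e)
theorem3p2 F n A B tA tB R S =
    ⇔-trans a⇔eigen eigen⇔XΔX≈ΔXΔ
  , ⇔-trans a⇔eigen (⇔-trans eigen⇔eigen-swap eigen⇔XΔX≈ΔXΔ)
  , ⇔-trans a⇔eigen (⇔-trans (eigen⇔diagonalisation tA B≉0) diagonalisation⇔ΔXΔ≈XΔX)
  , ⇔-trans a⇔eigen (⇔-trans eigen⇔eigen-swap
                              (⇔-trans (eigen⇔diagonalisation tB A≉0) diagonalisation-swap⇔ΔXΔ≈XΔX))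
  where
  open MatrixDefs F using (TypeII; NoZeroEntry; InN; Θ; _≈ᴹ_)
  open TypeIIEquivalences F
  A≉0 : NoZeroEntry A
  A≉0 = TypeII.noZero tA
  B≉0 : NoZeroEntry B
  B≉0 = TypeII.noZero tB
  a⇔eigen : Σ (InN A B R) (λ p → S ≈ᴹ Θ A B R p) ⇔ EigenEquations A B R S
  a⇔eigen = inN⇔eigen A≉0 B≉0
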